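{- Let $m,n\in\mathbb{N}$ and let $D\subseteq S_{0}$ be a $J$-set in the semigroup $(S_{0},\cdot)$. Then there exists $w\in S_{n}$ with $w\in\bigcap_{\vec{a}\in\mathbb{A}_{m}^{n}}h_{\vec{a}}^{ -1}[D]$, that is, $w(\vec{a})\in D$ for every $\vec{a}\in\mathbb{A}_{m}^{n}$.
   Context: Let $\mathbb{A}_{1}\subseteq\mathbb{A}_{2}\subseteq\cdots$ be an increasing sequence of finite nonempty alphabets and $\mathbb{A}=\bigcup_{i}\mathbb{A}_{i}$. $S_{0}$ is the set of all nonempty finite words over $\mathbb{A}$, a semigroup under concatenation. For $n\in\mathbb{N}$ let $v_{1},\dots,v_{n}$ be distinct variables not in $\mathbb{A}$; $S_{n}$ is the set of words over $\mathbb{A}\cup\{v_{1},\dots,v_{n}\}$ in which each $v_{i}$ occurs at least once. For $w\in S_{n}$ and $\vec{a}=(a_{1},\dots,a_{n})\in\mathbb{A}^{n}$, $w(\vec{a})$ is obtained by replacing each occurrence of $v_{i}$ by $a_{i}$; $h_{\vec{a}}:S_{n}\cup S_{0}\to S_{0}$ is the homomorphism given by $h_{\vec{a}}(w)=w(\vec{a})$ on $S_{n}$ and the identity on $S_{0}$. For a semigroup $S$, a set $B\subseteq S$ is a $J$-set if for every finite nonempty set $F$ of sequences $f:\mathbb{N}\to S$ there exist $m\in\mathbb{N}$, $a_{1},\dots,a_{m+1}\in S$ and $t_{1}<t_{2}<\cdots<t_{m}$ in $\mathbb{N}$ such that for each $f\in F$, $a_{1}f(t_{1})a_{2}f(t_{2})\cdots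 a_{m}f(t_{m})a_{m+1}\in B$. -}

module Defs where

open import Data.Nat using (ℕ; zero; suc; _≤_)
open import Data.Fin using (Fin; zero; suc) renaming (_<_ to _<ᶠ_)
open import Data.Sum using (_⊎_; inj₁; inj₂)
open import Data.Product using (Σ; ∃; _×_; _,_)
open import Data.List.NonEmpty using (List⁺; toList; map; _⁺++⁺_)
open import Data.List.Membership.Propositional using (_∈_)
open import Data.Nat using (_<_)

-- An increasing sequence of finite nonempty alphabets A₀ ⊆ A₁ ⊆ ⋯
-- (indexed from 0; paper's 𝔸_{i+1} is alph i) whose union is the
-- whole letter type L (so L plays the role of 𝔸).
record Alphabets : Set₁ where
  field
    L          : Set
    alph       : ℕ → List⁺ L
    increasing : ∀ i x → x ∈ toList (alph i) → x ∈ toList (alph (suc i))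
    covers     : ∀ (x : L) → ∃ λ i → x ∈ toList (alph i)

-- a₁ f(t₁) a₂ f(t₂) ⋯ a_k f(t_k) a_{k+1}, with a : Fin (k+1) → S, g i = f(t_i)
interleave : {S : Set} → (S → S → S) → (k : ℕ) → (Fin (suc k) → S) → (Fin k → S) → S
interleave _·_ zero    a g = a zero
interleave _·_ (suc k) a g = (a zero · g zero) · interleave _·_ k (λ i → a (suc i)) (λ i → g (suc i))

-- J-set in a semigroup (S, ·); the finite nonempty set F of sequences is
-- given as a nonempty list.
IsJSet : {S : Set} → (S → S → S) → (S → Set) → Set
IsJSet {S} _·_ B =
  (F : List⁺ (ℕ → S)) →
  Σ ℕ λ k → 1 ≤ k × Σ (Fin (suc k) → S) λ a → Σ (Fin k → ℕ) λ t →
    (∀ i j → i <ᶠ j → t i < t j) ×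
    (∀ f → f ∈ toList F → B (interleave _·_ k a (λ i → f (t i))))

module _ (𝔸 : Alphabets) where
  open Alphabets 𝔸

  S₀ : Set
  S₀ = List⁺ L

  Word : ℕ → Set
  Word n = List⁺ (L ⊎ Fin n)

  InS : (n : ℕ) → Word n → Set
  InS n w = ∀ (i : Fin n) → inj₂ i ∈ toList w

  subst : {n : ℕ} → Word n → (Fin n → L) → S₀
  subst w a = map (λ { (inj₁ x) → x ; (inj₂ i) → a i }) w

-- Apply the J-set property to the constant sequences t ↦ v₁v₂⋯vₙ(a⃗), one for
-- each a⃗ ∈ 𝔸ₘⁿ. It yields letters-only words c₁,…,c_{k+1}, k ≥ 1, with
-- c₁ v₁⋯vₙ(a⃗) c₂ ⋯ v₁⋯vₙ(a⃗) c_{k+1} ∈ D for every a⃗; since h_a⃗ is a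
-- homomorphism fixing letters, w = c₁ v₁⋯vₙ c₂ ⋯ v₁⋯vₙ c_{k+1} is the required
-- element of Sₙ.
module Submission where

open import Defs
open import Data.Nat using (ℕ; _≤_; zero; suc)
open import Data.Fin using (Fin; zero; suc)
open import Data.Product using (Σ; _×_; _,_)
open import Data.Sum using (inj₁; inj₂)
open import Data.List using (List; [_]; allFin; cartesianProductWith)
open import Data.List.NonEmpty using (_∷_; toList; _⁺++⁺_) renaming (map to map⁺)
open import Data.List.NonEmpty.Properties using (map-⁺++⁺; map-cong; map-∘; map-id)
open import Data.List.Relation.Unary.Any using (here; there)
open import Data.List.Membership.Propositional using (_∈_)
open import Data.List.Membership.Propositional.Properties
  using (∈-map⁺; ∈-++⁺ˡ; ∈-++⁺ʳ; ∈-allFin; ∈-cartesianProductWith⁺)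
open import Data.Vec using (Vec; lookup; tabulate)
import Data.Vec as Vec
import Data.List as List
open import Data.Vec.Properties using (lookup∘tabulate)
open import Function using (_∘_)
open import Relation.Binary.PropositionalEquality as ≡ using (_≡_; refl; sym; trans; cong₂)
open ≡.≡-Reasoning

module _ {S : Set} (_·_ : S → S → S) where

  interleave-cong : ∀ k {a a′ : Fin (suc k) → S} {g g′ : Fin k → S} →
    (∀ i → a i ≡ a′ i) → (∀ i → g i ≡ g′ i) →
    interleave _·_ k a g ≡ interleave _·_ k a′ g′
  interleave-cong zero    a≡a′ g≡g′ = a≡a′ zero
  interleave-cong (suc k) a≡a′ g≡g′ =
    cong₂ _·_ (cong₂ _·_ (a≡a′ zero) (g≡g′ zero))
              (interleave-cong k (a≡a′ ∘ suc) (g≡g′ ∘ suc))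

  interleave-homomorphic : {T : Set} (_∙_ : T → T → T) (h : S → T) →
    (∀ x y → h (x · y) ≡ h x ∙ h y) →
    ∀ k (a : Fin (suc k) → S) (g : Fin k → S) →
    h (interleave _·_ k a g) ≡ interleave _∙_ k (h ∘ a) (h ∘ g)
  interleave-homomorphic _∙_ h h-hom zero    a g = refl
  interleave-homomorphic _∙_ h h-hom (suc k) a g = begin
    h ((a zero · g zero) · rest)         ≡⟨ h-hom _ _ ⟩
    h (a zero · g zero) ∙ h rest         ≡⟨ cong₂ _∙_ (h-hom _ _)
                                              (interleave-homomorphic _∙_ h h-hom k (a ∘ suc) (g ∘ suc)) ⟩
    (h (a zero) ∙ h (g zero)) ∙ interleave _∙_ k (h ∘ a ∘ suc) (h ∘ g ∘ suc) ∎
    where rest = interleave _·_ k (a ∘ suc) (g ∘ suc)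

  -- The element of S pads the family to a nonempty one.
  IsJSet-list : {B : S → Set} → IsJSet _·_ B → S → (F : List (ℕ → S)) →
    Σ ℕ λ k → 1 ≤ k × Σ (Fin (suc k) → S) λ a → Σ (Fin k → ℕ) λ t →
      (∀ f → f ∈ F → B (interleave _·_ k a (f ∘ t)))
  IsJSet-list J s F with J ((λ _ → s) ∷ F)
  ... | k , 1≤k , a , t , _ , inF = k , 1≤k , a , t , λ f f∈F → inF f (there f∈F)

vectors : {A : Set} → List A → (n : ℕ) → List (Vec A n)
vectors xs zero    = [ Vec.[] ]
vectors xs (suc n) = cartesianProductWith Vec._∷_ xs (vectors xs n)

tabulate-∈-vectors : {A : Set} (xs : List A) (n : ℕ) (a : Fin n → A) →
  (∀ i → a i ∈ xs) → tabulate a ∈ vectors xs n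
tabulate-∈-vectors xs zero    a a∈xs = here refl
tabulate-∈-vectors xs (suc n) a a∈xs =
  ∈-cartesianProductWith⁺ Vec._∷_ (a∈xs zero)
    (tabulate-∈-vectors xs n (a ∘ suc) (a∈xs ∘ suc))

module _ (𝔸 : Alphabets) where
  open Alphabets 𝔸

  letters : {n : ℕ} → S₀ 𝔸 → Word 𝔸 n
  letters = map⁺ inj₁

  variables : (n : ℕ) → Word 𝔸 (suc n)
  variables n = inj₂ zero ∷ List.map (inj₂ ∘ suc) (allFin n)

  variables-InS : (n : ℕ) → InS 𝔸 (suc n) (variables n)
  variables-InS n zero    = here refl
  variables-InS n (suc i) = there (∈-map⁺ (inj₂ ∘ suc) (∈-allFin i))

  InS-interleave : {n : ℕ} (k : ℕ) (c : Fin (suc (suc k)) → Word 𝔸 n) (w : Word 𝔸 n) →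
    InS 𝔸 n w → InS 𝔸 n (interleave _⁺++⁺_ (suc k) c (λ _ → w))
  InS-interleave k c w w∈Sₙ i = ∈-++⁺ˡ (∈-++⁺ʳ (toList (c zero)) (w∈Sₙ i))

  subst-++ : {n : ℕ} (a : Fin n → L) (u v : Word 𝔸 n) →
    subst 𝔸 (u ⁺++⁺ v) a ≡ subst 𝔸 u a ⁺++⁺ subst 𝔸 v a
  subst-++ a u v = map-⁺++⁺ _ u v

  subst-letters : {n : ℕ} (a : Fin n → L) (u : S₀ 𝔸) → subst 𝔸 (letters u) a ≡ u
  subst-letters a u = trans (sym (map-∘ u)) (map-id u)

  subst-cong : {n : ℕ} (w : Word 𝔸 n) {a b : Fin n → L} → (∀ i → a i ≡ b i) →
    subst 𝔸 w a ≡ subst 𝔸 w b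
  subst-cong w a≡b = map-cong (λ { (inj₁ x) → refl ; (inj₂ i) → a≡b i }) w

  subst-interleave : {n : ℕ} (a : Fin n → L) (k : ℕ) (c : Fin (suc k) → S₀ 𝔸) (w : Word 𝔸 n) →
    subst 𝔸 (interleave _⁺++⁺_ k (letters ∘ c) (λ _ → w)) a
      ≡ interleave _⁺++⁺_ k c (λ _ → subst 𝔸 w a)
  subst-interleave a k c w =
    trans (interleave-homomorphic _⁺++⁺_ _⁺++⁺_ (λ u → subst 𝔸 u a) (subst-++ a) k _ _)
          (interleave-cong _⁺++⁺_ k (subst-letters a ∘ c) (λ _ → refl))

mainTheorem2 : (𝔸 : Alphabets) (m n : ℕ) → 1 ≤ n →
    (D : S₀ 𝔸 → Set) → IsJSet _⁺++⁺_ D →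
    Σ (Word 𝔸 n) λ w → InS 𝔸 n w ×
    ((a : Fin n → Alphabets.L 𝔸) →
    (∀ i → a i ∈ toList (Alphabets.alph 𝔸 m)) → D (subst 𝔸 w a))
mainTheorem2 𝔸 m (suc n) _ D J
  with IsJSet-list _⁺++⁺_ {D} J (alph 0) (List.map sequence (vectors (toList (alph m)) (suc n)))
  where
  open Alphabets 𝔸
  sequence : Vec L (suc n) → ℕ → S₀ 𝔸
  sequence v _ = subst 𝔸 (variables 𝔸 n) (lookup v)
... | suc k , _ , c , _ , inD = w , InS-interleave 𝔸 k (letters 𝔸 ∘ c) _ (variables-InS 𝔸 n) , w∈D
  where
  open Alphabets 𝔸
  w : Word 𝔸 (suc n)
  w = interleave _⁺++⁺_ (suc k) (letters 𝔸 ∘ c) (λ _ → variables 𝔸 n)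
  w∈D : (a : Fin (suc n) → L) → (∀ i → a i ∈ toList (alph m)) → D (subst 𝔸 w a)
  w∈D a a∈𝔸ₘ = ≡.subst D (sym w[a]) (inD _ (∈-map⁺ _ (tabulate-∈-vectors _ (suc n) a a∈𝔸ₘ)))
    where
    w[a] : subst 𝔸 w a ≡ interleave _⁺++⁺_ (suc k) c (λ _ → subst 𝔸 (variables 𝔸 n) (lookup (tabulate a)))
    w[a] = trans (subst-interleave 𝔸 a (suc k) c (variables 𝔸 n))
      (interleave-cong _⁺++⁺_ (suc k) {a = c} (λ _ → refl)
        (λ _ → subst-cong 𝔸 (variables 𝔸 n) (sym ∘ lookup∘tabulate a)))
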